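{- For integers $j\ge0$, $m\ge1$ and $r\in\{0,\ldots,m-1\}$, \[ \sum_{k=0}^{\lfloor (mj+r)/2\rfloor}\left\langle {mj+r-k \atop k}\right\rangle_m=f_j^{m-r}f_{j+1}^r. \]
   Context: An $N$-board is a linear array of $N$ unit cells. A square is a $1\times1$ tile; a $(1,m-1)$-fence is a tile consisting of two unit square posts separated by a gap of width $m-1$, whose gap may be occupied by other tiles. $\left\langle {n \atop k}\right\rangle_m$ denotes the number of tilings of an $(n+k)$-board using exactly $k$ $(1,m-1)$-fences and $n-k$ squares. $f_n$ are the Fibonacci numbers with $f_n=f_{n-1}+f_{n-2}+\delta_{n,0}$, $f_n=0$ for $n<0$ (so $f_0=f_1=1$). -}

module Defs where

open import Data.Nat using (ℕ; zero; suc; _+_; _*_; _∸_; _<ᵇ_; _≤ᵇ_)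
open import Data.Bool using (Bool; true; false; _∧_; _∨_; not; if_then_else_)
open import Data.List using (List; []; _∷_; length; filter; map; concatMap; upTo)
open import Data.Nat.ListAction using (sum)
open import Data.Maybe using (Maybe; just; nothing)
open import Relation.Nullary.Decidable using (yes; no)
open import Data.Bool.Properties using (T?)

fib : ℕ → ℕ
fib zero = 1
fib (suc zero) = 1
fib (suc (suc n)) = fib (suc n) + fib n

-- Contents of a cell of a board.  A (1,m-1)-fence occupying cells i and i+m
-- is recorded as  post-L  at cell i and  post-R  at cell i+m.
data Cell : Set where
  square post-L post-R : Cell

at : List Cell → ℕ → Maybe Cell
at []       _       = nothing
at (c ∷ cs) zero    = just c
at (c ∷ cs) (suc i) = at cs i

isL : List Cell → ℕ → Bool
isL t i with at t i
... | just post-L = true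
... | _           = false

isR : List Cell → ℕ → Bool
isR t i with at t i
... | just post-R = true
... | _           = false

_==_ : Bool → Bool → Bool
true  == b = b
false == b = not b

-- A labelling t of the board (cells 0..length t - 1) is a tiling by squares
-- and (1,m-1)-fences iff: cell i holds a left post exactly when cell i+m holds
-- a right post, and every right post at i has i ≥ m (so its left post i-m exists).
-- Hence the fences are exactly the pairs {i, i+m} of posts, squares fill the rest,
-- and every cell is covered by exactly one tile.
isTiling : ℕ → List Cell → Bool
isTiling m t = go (length t)
  where
  go : ℕ → Bool
  go zero    = true
  go (suc i) = (isL t i == isR t (i + m))
             ∧ (not (isR t i) ∨ (m ≤ᵇ i))
             ∧ go i

boards : ℕ → List (List Cell)
boards zero    = [] ∷ []
boards (suc N) = concatMap (λ t → (square ∷ t) ∷ (post-L ∷ t) ∷ (post-R ∷ t) ∷ []) (boards N)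

fences : List Cell → ℕ
fences []            = 0
fences (post-L ∷ cs) = suc (fences cs)
fences (_ ∷ cs)      = fences cs

_=ℕ_ : ℕ → ℕ → Bool
a =ℕ b = (a ≤ᵇ b) ∧ (b ≤ᵇ a)

-- ⟨ n k ⟩_m : number of tilings of an (n+k)-board with exactly k (1,m-1)-fences
-- (and hence n-k squares).
angle : ℕ → ℕ → ℕ → ℕ
angle m n k = length (filter (λ t → T? (isTiling m t ∧ (fences t =ℕ k))) (boards (n + k)))

sumTo : ℕ → (ℕ → ℕ) → ℕ
sumTo K g = sum (map g (upTo (suc K)))

{-# OPTIONS --safe #-}
module Submission where

-- A fence joins cells i and i + m, so a tiling of an N-board is the same as an
-- independent tiling, by squares and dominoes, of each of the m residue classes
-- of cells mod m. For N = m j + r, r classes have j + 1 cells and m − r have j,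
-- and a class of l cells has f_l tilings; this gives the product. The sum over k
-- counts every tiling exactly once, because a tiling has at most N / 2 fences.
-- To make the splitting formal, the board is read left to right while a window
-- of m flags records which of the next m cells are right posts owed to fences
-- already opened. The number of boards accepted from a window is a product over
-- its slots, and reading one cell rotates the window by one slot.

open import Defs
open import Data.Bool using (Bool; true; false; _∧_; _∨_; not)
open import Data.Bool.Properties using (∧-conicalˡ; ∧-conicalʳ; ⇔→≡; T-≡)
open import Data.Empty using (⊥-elim)
open import Data.List using (List; []; _∷_; _++_; length; map; filter; concatMap; upTo; applyUpTo)
open import Data.List.Properties using (map-++; map-cong; map-cong-local; map-upTo)
open import Data.List.Relation.Unary.All as All using (All; []; _∷_)
open import Data.List.Relation.Unary.All.Properties using (concat⁺; map⁺; all-upTo)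
open import Data.Nat using (ℕ; zero; suc; _+_; _*_; _∸_; _^_; _≤_; _<_; _≤ᵇ_; ⌊_/2⌋; z≤n; s≤s)
open import Data.Nat.ListAction using (sum)
open import Data.Nat.ListAction.Properties using (sum-++)
open import Data.Nat.Properties
open import Algebra.Properties.CommutativeSemigroup +-commutativeSemigroup using (interchange)
open import Algebra.Properties.CommutativeSemigroup *-commutativeSemigroup using (x∙yz≈y∙xz)
open import Data.Nat.Tactic.RingSolver using (solve-∀)
open import Data.Product using (Σ; _×_; _,_; proj₁; proj₂)
open import Data.Product.Function.NonDependent.Propositional using (_×-⇔_)
open import Data.Sum using (inj₁; inj₂)
open import Data.Vec using (Vec; []; _∷_; _∷ʳ_; replicate)
open import Function using (_∘_)
open import Function.Bundles using (_⇔_; mk⇔; Equivalence)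
import Function.Properties.Equivalence as ⇔
open import Relation.Binary.PropositionalEquality
open import Relation.Nullary using (yes; no)
open import Relation.Nullary.Decidable using (T?)

private
  variable
    A B : Set
    n m : ℕ
    b : Bool
    c : Cell
    t : List Cell

==-true : ∀ {a b} → (a == b) ≡ true ⇔ a ≡ b
==-true {true}  {true}  = mk⇔ (λ _ → refl) (λ _ → refl)
==-true {true}  {false} = mk⇔ (λ ()) (λ ())
==-true {false} {true}  = mk⇔ (λ ()) (λ ())
==-true {false} {false} = mk⇔ (λ _ → refl) (λ _ → refl)

∧-true : ∀ a {b} → a ∧ b ≡ true ⇔ (a ≡ true × b ≡ true)
∧-true a {b} = mk⇔ (λ p → ∧-conicalˡ a b p , ∧-conicalʳ a b p) λ { (refl , refl) → refl }

not∨≤ᵇ-true : ∀ {r} i → (not r ∨ (m ≤ᵇ i)) ≡ true ⇔ (i < m → r ≡ false)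
not∨≤ᵇ-true {m} {false} i = mk⇔ (λ _ _ → refl) (λ _ → refl)
not∨≤ᵇ-true {m} {true}  i = mk⇔ sound complete
  where
  sound : (m ≤ᵇ i) ≡ true → i < m → true ≡ false
  sound m≤ᵇi i<m = ⊥-elim (<⇒≱ i<m (≤ᵇ⇒≤ m i (Equivalence.from T-≡ m≤ᵇi)))
  complete : (i < m → true ≡ false) → (m ≤ᵇ i) ≡ true
  complete i<m⇒⊥ with m ≤? i
  ... | yes m≤i = Equivalence.to T-≡ (≤⇒≤ᵇ m≤i)
  ... | no m≰i with i<m⇒⊥ (≰⇒> m≰i)
  ... | ()

indicator : Bool → ℕ
indicator true  = 1
indicator false = 0

∑ : List A → (A → ℕ) → ℕ
∑ xs g = sum (map g xs)

syntax ∑ xs (λ x → g) = ∑[ x ∈ xs ] g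

∑-cong : ∀ {g h : A → ℕ} → (∀ x → g x ≡ h x) → ∀ xs → ∑ xs g ≡ ∑ xs h
∑-cong g≗h xs = cong sum (map-cong g≗h xs)

∑-cong-local : ∀ {g h : A → ℕ} {xs} → All (λ x → g x ≡ h x) xs → ∑ xs g ≡ ∑ xs h
∑-cong-local g≗h = cong sum (map-cong-local g≗h)

∑-zero : ∀ (xs : List A) → ∑[ x ∈ xs ] 0 ≡ 0
∑-zero []       = refl
∑-zero (x ∷ xs) = ∑-zero xs

∑-+ : ∀ (xs : List A) (g h : A → ℕ) → ∑[ x ∈ xs ] (g x + h x) ≡ ∑ xs g + ∑ xs h
∑-+ []       g h = refl
∑-+ (x ∷ xs) g h = trans (cong (g x + h x +_) (∑-+ xs g h)) (interchange (g x) (h x) _ _)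

∑-++ : ∀ (xs ys : List A) g → ∑ (xs ++ ys) g ≡ ∑ xs g + ∑ ys g
∑-++ xs ys g = trans (cong sum (map-++ g xs ys)) (sum-++ (map g xs) (map g ys))

∑-concatMap : ∀ (f : A → List B) xs g → ∑ (concatMap f xs) g ≡ ∑[ x ∈ xs ] ∑ (f x) g
∑-concatMap f []       g = refl
∑-concatMap f (x ∷ xs) g = trans (∑-++ (f x) _ g) (cong (∑ (f x) g +_) (∑-concatMap f xs g))

∑-comm : ∀ (xs : List A) (ys : List B) (h : A → B → ℕ) →
         ∑[ x ∈ xs ] ∑[ y ∈ ys ] h x y ≡ ∑[ y ∈ ys ] ∑[ x ∈ xs ] h x y
∑-comm []       ys h = sym (∑-zero ys)
∑-comm (x ∷ xs) ys h = trans (cong (∑ ys (h x) +_) (∑-comm xs ys h)) (sym (∑-+ ys (h x) (λ y → ∑[ x ∈ xs ] h x y)))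

length-filter≡∑ : ∀ (p : A → Bool) xs → length (filter (T? ∘ p) xs) ≡ ∑[ x ∈ xs ] indicator (p x)
length-filter≡∑ p []       = refl
length-filter≡∑ p (x ∷ xs) with p x
... | true  = cong suc (length-filter≡∑ p xs)
... | false = length-filter≡∑ p xs

=ℕ-suc : ∀ a b → (suc a =ℕ suc b) ≡ (a =ℕ b)
=ℕ-suc zero    zero    = refl
=ℕ-suc zero    (suc b) = refl
=ℕ-suc (suc a) zero    = refl
=ℕ-suc (suc a) (suc b) = refl

sum-applyUpTo-zero : ∀ K {g : ℕ → ℕ} → (∀ k → g k ≡ 0) → sum (applyUpTo g K) ≡ 0
sum-applyUpTo-zero zero    g≗0 = refl
sum-applyUpTo-zero (suc K) g≗0 = cong₂ _+_ (g≗0 0) (sum-applyUpTo-zero K (g≗0 ∘ suc))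

sum-applyUpTo-indicator : ∀ f K {g : ℕ → ℕ} → (∀ k → g k ≡ indicator (f =ℕ k)) → f ≤ K →
                          sum (applyUpTo g (suc K)) ≡ 1
sum-applyUpTo-indicator zero    K       g≗ _         = cong₂ _+_ (g≗ 0) (sum-applyUpTo-zero K (g≗ ∘ suc))
sum-applyUpTo-indicator (suc f) (suc K) g≗ (s≤s f≤K) =
  cong₂ _+_ (g≗ 0) (sum-applyUpTo-indicator f K (λ k → trans (g≗ (suc k)) (cong indicator (=ℕ-suc f k))) f≤K)

∑-indicator-=ℕ : ∀ b f K → (b ≡ true → f ≤ K) → ∑[ k ∈ upTo (suc K) ] indicator (b ∧ (f =ℕ k)) ≡ indicator b
∑-indicator-=ℕ false f K _   = ∑-zero (upTo (suc K))
∑-indicator-=ℕ true  f K f≤K =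
  trans (cong sum (map-upTo _ (suc K))) (sum-applyUpTo-indicator f K (λ _ → refl) (f≤K refl))

-- `pending i` tells whether cell i < m is the right post of a fence whose left
-- post lies before the board.
PairedAt : ℕ → (ℕ → Bool) → List Cell → ℕ → Set
PairedAt m pending t i = (isL t i ≡ isR t (i + m)) × (i < m → isR t i ≡ pending i)

Paired : ℕ → (ℕ → Bool) → List Cell → Set
Paired m pending t = ∀ i → PairedAt m pending t i

Paired-cong : ∀ {p q} → (∀ i → p i ≡ q i) → Paired m p t ⇔ Paired m q t
Paired-cong p≗q = mk⇔ (λ P i → proj₁ (P i) , λ i<m → trans (proj₂ (P i) i<m) (p≗q i))
                      (λ P i → proj₁ (P i) , λ i<m → trans (proj₂ (P i) i<m) (sym (p≗q i)))

isL-beyond : ∀ t i → length t ≤ i → isL t i ≡ false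
isL-beyond []      i       _         = refl
isL-beyond (c ∷ t) (suc i) (s≤s t≤i) = isL-beyond t i t≤i

isR-beyond : ∀ t i → length t ≤ i → isR t i ≡ false
isR-beyond []      i       _         = refl
isR-beyond (c ∷ t) (suc i) (s≤s t≤i) = isR-beyond t i t≤i

PairedAt-beyond : ∀ t i → length t ≤ i → PairedAt m (λ _ → false) t i
PairedAt-beyond {m} t i t≤i =
  trans (isL-beyond t i t≤i) (sym (isR-beyond t (i + m) (≤-trans t≤i (m≤m+n i m)))) ,
  λ _ → isR-beyond t i t≤i

-- The loop run by `isTiling` is local to its definition; abstracting the board
-- length in its unfolding exposes the loop as a function.
tilingLoop : (m : ℕ) (t : List Cell) → Σ (ℕ → Bool) λ loop → ∀ n → length t ≡ n → isTiling m t ≡ loop n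
tilingLoop m t = _ , unfold
  where
  unfold : ∀ n → length t ≡ n → isTiling m t ≡ _
  unfold n eq rewrite eq = refl

loop-true : ∀ t n → proj₁ (tilingLoop m t) n ≡ true ⇔ (∀ i → i < n → PairedAt m (λ _ → false) t i)
loop-true t zero = mk⇔ (λ _ _ ()) (λ _ → refl)
loop-true {m} t (suc n) = mk⇔ sound complete
  where
  open Equivalence
  sound : proj₁ (tilingLoop m t) (suc n) ≡ true → ∀ i → i < suc n → PairedAt m (λ _ → false) t i
  sound ok i i<1+n with to (∧-true (isL t n == isR t (n + m))) ok | m<1+n⇒m<n∨m≡n i<1+n
  ... | _      , rest | inj₁ i<n  = to (loop-true t n) (proj₂ (to (∧-true _) rest)) i i<n
  ... | paired , rest | inj₂ refl = to ==-true paired , to (not∨≤ᵇ-true i) (proj₁ (to (∧-true _) rest))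
  complete : (∀ i → i < suc n → PairedAt m (λ _ → false) t i) → proj₁ (tilingLoop m t) (suc n) ≡ true
  complete P = from (∧-true _) (from ==-true (proj₁ (P n ≤-refl)) ,
               from (∧-true _) (from (not∨≤ᵇ-true n) (proj₂ (P n ≤-refl)) ,
               from (loop-true t n) (λ i i<n → P i (m≤n⇒m≤1+n i<n))))

isTiling⇔Paired : ∀ t → isTiling m t ≡ true ⇔ Paired m (λ _ → false) t
isTiling⇔Paired {m} t = mk⇔ sound complete
  where
  open Equivalence
  sound : isTiling m t ≡ true → Paired m (λ _ → false) t
  sound ok i with i <? length t
  ... | yes i<t = to (loop-true t (length t)) ok i i<t
  ... | no  i≮t = PairedAt-beyond t i (≮⇒≥ i≮t)
  complete : Paired m (λ _ → false) t → isTiling m t ≡ true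
  complete P = from (loop-true t (length t)) (λ i _ → P i)

slot : Vec Bool n → ℕ → Bool
slot []      _       = false
slot (b ∷ _) zero    = b
slot (_ ∷ w) (suc i) = slot w i

slot-∷ʳ-< : ∀ (w : Vec Bool n) x {i} → i < n → slot (w ∷ʳ x) i ≡ slot w i
slot-∷ʳ-< (b ∷ w) x {zero}  _         = refl
slot-∷ʳ-< (b ∷ w) x {suc i} (s≤s i<n) = slot-∷ʳ-< w x i<n

slot-∷ʳ-last : ∀ (w : Vec Bool n) x → slot (w ∷ʳ x) n ≡ x
slot-∷ʳ-last []      x = refl
slot-∷ʳ-last (b ∷ w) x = slot-∷ʳ-last w x

slot-replicate : ∀ n i → slot (replicate n false) i ≡ false
slot-replicate zero    i       = refl
slot-replicate (suc n) zero    = refl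
slot-replicate (suc n) (suc i) = slot-replicate n i

vacant : Vec Bool n → Bool
vacant []      = true
vacant (b ∷ w) = not b ∧ vacant w

vacant-true : ∀ (w : Vec Bool n) → vacant w ≡ true ⇔ (∀ i → i < n → slot w i ≡ false)
vacant-true []          = mk⇔ (λ _ _ ()) (λ _ → refl)
vacant-true (true ∷ w)  = mk⇔ (λ ()) (λ P → sym (P 0 (s≤s z≤n)))
vacant-true (false ∷ w) = mk⇔ (λ ok → λ { zero _ → refl ; (suc i) (s≤s i<n) → Equivalence.to (vacant-true w) ok i i<n })
                              (λ P → Equivalence.from (vacant-true w) (λ i i<n → P (suc i) (s≤s i<n)))

-- Slot i of the window flags whether the i-th unread cell must be the right
-- post of a fence whose left post has been read.
accepts : Vec Bool (suc n) → List Cell → Bool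
accepts w       []      = vacant w
accepts (b ∷ w) (c ∷ t) = (isR (c ∷ t) 0 == b) ∧ accepts (w ∷ʳ isL (c ∷ t) 0) t

accepts-[]⇔Paired : ∀ (w : Vec Bool (suc n)) → accepts w [] ≡ true ⇔ Paired (suc n) (slot w) []
accepts-[]⇔Paired w = mk⇔ (λ ok i → refl , λ i<m → sym (Equivalence.to (vacant-true w) ok i i<m))
                          (λ P → Equivalence.from (vacant-true w) (λ i i<m → sym (proj₂ (P i) i<m)))

Paired-∷ : ∀ (w : Vec Bool n) →
           Paired (suc n) (slot (b ∷ w)) (c ∷ t) ⇔ (isR (c ∷ t) 0 ≡ b × Paired (suc n) (slot (w ∷ʳ isL (c ∷ t) 0)) t)
Paired-∷ {n} {b} {c} {t} w = mk⇔ sound complete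
  where
  x = isL (c ∷ t) 0
  sound : Paired (suc n) (slot (b ∷ w)) (c ∷ t) → isR (c ∷ t) 0 ≡ b × Paired (suc n) (slot (w ∷ʳ x)) t
  sound P = proj₂ (P 0) (s≤s z≤n) , λ i → proj₁ (P (suc i)) , shifted i
    where
    shifted : ∀ i → i < suc n → isR t i ≡ slot (w ∷ʳ x) i
    shifted i i<1+n with m<1+n⇒m<n∨m≡n i<1+n
    ... | inj₁ i<n  = trans (proj₂ (P (suc i)) (s≤s i<n)) (sym (slot-∷ʳ-< w x i<n))
    ... | inj₂ refl = trans (sym (proj₁ (P 0))) (sym (slot-∷ʳ-last w x))
  complete : isR (c ∷ t) 0 ≡ b × Paired (suc n) (slot (w ∷ʳ x)) t → Paired (suc n) (slot (b ∷ w)) (c ∷ t)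
  complete (c≡b , P) zero    = sym (trans (proj₂ (P n) ≤-refl) (slot-∷ʳ-last w x)) , λ _ → c≡b
  complete (c≡b , P) (suc i) = proj₁ (P i) , λ { (s≤s i<n) → trans (proj₂ (P i) (m≤n⇒m≤1+n i<n)) (slot-∷ʳ-< w x i<n) }

accepts⇔Paired : ∀ (w : Vec Bool (suc n)) t → accepts w t ≡ true ⇔ Paired (suc n) (slot w) t
accepts⇔Paired w       []      = accepts-[]⇔Paired w
accepts⇔Paired (b ∷ w) (c ∷ t) =
  ⇔.trans (∧-true _) (⇔.trans (==-true ×-⇔ accepts⇔Paired (w ∷ʳ isL (c ∷ t) 0) t) (⇔.sym (Paired-∷ {c = c} {t = t} w)))

isTiling≡accepts : ∀ t → isTiling (suc n) t ≡ accepts (replicate (suc n) false) t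
isTiling≡accepts {n} t = ⇔→≡ (⇔.trans (isTiling⇔Paired t)
                       (⇔.trans (Paired-cong {t = t} (λ i → sym (slot-replicate (suc n) i)))
                                (⇔.sym (accepts⇔Paired (replicate (suc n) false) t))))

boards-length : ∀ N → All (λ t → length t ≡ N) (boards N)
boards-length zero    = refl ∷ []
boards-length (suc N) = concat⁺ (map⁺ (All.map (λ eq → cong suc eq ∷ cong suc eq ∷ cong suc eq ∷ []) (boards-length N)))

∑-boards-suc : ∀ N g → ∑ (boards (suc N)) g ≡ ∑[ t ∈ boards N ] (g (square ∷ t) + (g (post-L ∷ t) + (g (post-R ∷ t) + 0)))
∑-boards-suc N g = ∑-concatMap _ (boards N) g

accepted : Vec Bool (suc n) → ℕ → ℕ
accepted w N = ∑[ t ∈ boards N ] indicator (accepts w t)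

accepted-true∷ : ∀ (w : Vec Bool n) N → accepted (true ∷ w) (suc N) ≡ accepted (w ∷ʳ false) N
accepted-true∷ w N = trans (∑-boards-suc N _) (∑-cong (λ t → +-identityʳ _) (boards N))

accepted-false∷ : ∀ (w : Vec Bool n) N → accepted (false ∷ w) (suc N) ≡ accepted (w ∷ʳ false) N + accepted (w ∷ʳ true) N
accepted-false∷ w N =
  trans (∑-boards-suc N _)
        (trans (∑-cong (λ t → cong (indicator (accepts (w ∷ʳ false) t) +_) (+-identityʳ _)) (boards N))
               (∑-+ (boards N) _ _))

-- Tilings of a residue class of l cells by squares and dominoes (the fences
-- within that class), when its first cell is free or already a right post.
classTilings : ℕ → Bool → ℕ
classTilings l       false = fib l
classTilings zero    true  = 0
classTilings (suc l) true  = fib l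

fib-suc : ∀ l → fib (suc l) ≡ classTilings l false + classTilings l true
fib-suc zero    = refl
fib-suc (suc l) = refl

classProduct : Vec ℕ n → Vec Bool n → ℕ
classProduct []       []      = 1
classProduct (l ∷ ls) (b ∷ w) = classTilings l b * classProduct ls w

classProduct-∷ʳ : ∀ (ls : Vec ℕ n) l w b → classProduct (ls ∷ʳ l) (w ∷ʳ b) ≡ classProduct ls w * classTilings l b
classProduct-∷ʳ []       l []      b = *-comm (classTilings l b) 1
classProduct-∷ʳ (k ∷ ls) l (c ∷ w) b =
  trans (cong (classTilings k c *_) (classProduct-∷ʳ ls l w b)) (sym (*-assoc (classTilings k c) _ _))

accepted-rotate : ∀ N (ls : Vec ℕ n) l → (∀ w → accepted w N ≡ classProduct (ls ∷ʳ l) w) →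
                  ∀ w → accepted w (suc N) ≡ classProduct (suc l ∷ ls) w
accepted-rotate N ls l counts (true ∷ w) = begin
  accepted (true ∷ w) (suc N)             ≡⟨ accepted-true∷ w N ⟩
  accepted (w ∷ʳ false) N                 ≡⟨ counts (w ∷ʳ false) ⟩
  classProduct (ls ∷ʳ l) (w ∷ʳ false)     ≡⟨ classProduct-∷ʳ ls l w false ⟩
  classProduct ls w * fib l               ≡⟨ *-comm _ (fib l) ⟩
  fib l * classProduct ls w               ∎
  where open ≡-Reasoning
accepted-rotate N ls l counts (false ∷ w) = begin
  accepted (false ∷ w) (suc N)                         ≡⟨ accepted-false∷ w N ⟩
  accepted (w ∷ʳ false) N + accepted (w ∷ʳ true) N     ≡⟨ cong₂ _+_ (counts (w ∷ʳ false)) (counts (w ∷ʳ true)) ⟩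
  classProduct (ls ∷ʳ l) (w ∷ʳ false) + classProduct (ls ∷ʳ l) (w ∷ʳ true)
    ≡⟨ cong₂ _+_ (classProduct-∷ʳ ls l w false) (classProduct-∷ʳ ls l w true) ⟩
  P * classTilings l false + P * classTilings l true   ≡⟨ sym (*-distribˡ-+ P _ _) ⟩
  P * (classTilings l false + classTilings l true)     ≡⟨ cong (P *_) (sym (fib-suc l)) ⟩
  P * fib (suc l)                                      ≡⟨ *-comm P _ ⟩
  fib (suc l) * P                                      ∎
  where
  open ≡-Reasoning
  P = classProduct ls w

-- For r ≤ n, entry i is the number of cells ≡ i (mod n) of an (n j + r)-board.
classLengths : ℕ → ℕ → (n : ℕ) → Vec ℕ n
classLengths j r       zero    = []
classLengths j zero    (suc n) = j ∷ classLengths j zero n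
classLengths j (suc r) (suc n) = suc j ∷ classLengths j r n

classLengths-∷ʳ : ∀ j {r n} → r ≤ n → classLengths j r (suc n) ≡ classLengths j r n ∷ʳ j
classLengths-∷ʳ j {zero}  {zero}  _         = refl
classLengths-∷ʳ j {zero}  {suc n} _         = cong (j ∷_) (classLengths-∷ʳ j z≤n)
classLengths-∷ʳ j {suc r} {suc n} (s≤s r≤n) = cong (suc j ∷_) (classLengths-∷ʳ j r≤n)

classLengths-full : ∀ j n → classLengths j n n ≡ classLengths (suc j) zero n
classLengths-full j zero    = refl
classLengths-full j (suc n) = cong (suc j ∷_) (classLengths-full j n)

classProduct-empty : ∀ (w : Vec Bool n) → classProduct (classLengths zero zero n) w ≡ indicator (vacant w)
classProduct-empty []          = refl
classProduct-empty (true ∷ w)  = refl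
classProduct-empty (false ∷ w) = trans (+-identityʳ _) (classProduct-empty w)

accepted≡classProduct : ∀ j r → r ≤ suc n → ∀ w → accepted w (suc n * j + r) ≡ classProduct (classLengths j r (suc n)) w
accepted≡classProduct {n} zero zero _ w rewrite *-zeroʳ n = trans (+-identityʳ _) (sym (classProduct-empty w))
accepted≡classProduct {n} (suc j) zero _ w = begin
  accepted w (suc n * suc j + 0)                     ≡⟨ cong (accepted w) (trans (+-identityʳ _) (trans (*-suc (suc n) j) (+-comm (suc n) _))) ⟩
  accepted w (suc n * j + suc n)                     ≡⟨ accepted≡classProduct j (suc n) ≤-refl w ⟩
  classProduct (classLengths j (suc n) (suc n)) w    ≡⟨ cong (λ ls → classProduct ls w) (classLengths-full j (suc n)) ⟩
  classProduct (classLengths (suc j) zero (suc n)) w ∎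
  where open ≡-Reasoning
accepted≡classProduct {n} j (suc r) (s≤s r≤n) w = begin
  accepted w (suc n * j + suc r)                  ≡⟨ cong (accepted w) (+-suc (suc n * j) r) ⟩
  accepted w (suc (suc n * j + r))                ≡⟨ accepted-rotate (suc n * j + r) (classLengths j r n) j previous w ⟩
  classProduct (classLengths j (suc r) (suc n)) w ∎
  where
  open ≡-Reasoning
  previous : ∀ w → accepted w (suc n * j + r) ≡ classProduct (classLengths j r n ∷ʳ j) w
  previous w = trans (accepted≡classProduct j r (m≤n⇒m≤1+n r≤n) w) (cong (λ ls → classProduct ls w) (classLengths-∷ʳ j r≤n))

classProduct-vacant : ∀ j {r} n → r ≤ n → classProduct (classLengths j r n) (replicate n false) ≡ fib j ^ (n ∸ r) * fib (suc j) ^ r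
classProduct-vacant j {zero}  zero    _ = refl
classProduct-vacant j {zero}  (suc n) _ = trans (cong (fib j *_) (classProduct-vacant j n z≤n)) (sym (*-assoc (fib j) _ _))
classProduct-vacant j {suc r} (suc n) (s≤s r≤n) =
  trans (cong (fib (suc j) *_) (classProduct-vacant j n r≤n)) (x∙yz≈y∙xz (fib (suc j)) (fib j ^ (n ∸ r)) (fib (suc j) ^ r))

trues : Vec Bool n → ℕ
trues []      = 0
trues (b ∷ w) = indicator b + trues w

trues-∷ʳ : ∀ (w : Vec Bool n) b → trues (w ∷ʳ b) ≡ trues w + indicator b
trues-∷ʳ []      b = +-identityʳ _
trues-∷ʳ (c ∷ w) b = trans (cong (indicator c +_) (trues-∷ʳ w b)) (sym (+-assoc (indicator c) _ _))

vacant⇒trues≡0 : ∀ (w : Vec Bool n) → vacant w ≡ true → trues w ≡ 0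
vacant⇒trues≡0 []          _  = refl
vacant⇒trues≡0 (false ∷ w) ok = vacant⇒trues≡0 w ok

-- Each fence uses two cells, and each flag of the window claims one more.
accepts⇒fences-bound : ∀ (w : Vec Bool (suc n)) t → accepts w t ≡ true → fences t + fences t + trues w ≤ length t
accepts⇒fences-bound w           []           ok = ≤-reflexive (vacant⇒trues≡0 w ok)
accepts⇒fences-bound (false ∷ w) (square ∷ t) ok =
  m≤n⇒m≤1+n (subst (λ k → fences t + fences t + k ≤ length t) (trans (trues-∷ʳ w false) (+-identityʳ _)) (accepts⇒fences-bound _ t ok))
accepts⇒fences-bound (false ∷ w) (post-L ∷ t) ok =
  s≤s (subst (_≤ length t) (regroup (fences t) (trues w))
             (subst (λ k → fences t + fences t + k ≤ length t) (trues-∷ʳ w true) (accepts⇒fences-bound _ t ok)))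
  where
  regroup : ∀ f k → f + f + (k + 1) ≡ f + suc f + k
  regroup = solve-∀
accepts⇒fences-bound (true ∷ w)  (post-R ∷ t) ok =
  subst (_≤ suc (length t)) (sym (+-suc _ (trues w)))
        (s≤s (subst (λ k → fences t + fences t + k ≤ length t) (trans (trues-∷ʳ w false) (+-identityʳ _)) (accepts⇒fences-bound _ t ok)))
accepts⇒fences-bound (false ∷ w) (post-R ∷ t) ()
accepts⇒fences-bound (true ∷ w)  (square ∷ t) ()
accepts⇒fences-bound (true ∷ w)  (post-L ∷ t) ()

fences≤half : ∀ t → isTiling (suc n) t ≡ true → fences t ≤ ⌊ length t /2⌋
fences≤half {n} t ok = subst (_≤ ⌊ length t /2⌋) (sym (n≡⌊n+n/2⌋ (fences t))) (⌊n/2⌋-mono double≤)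
  where
  double≤ : fences t + fences t ≤ length t
  double≤ = ≤-trans (m≤m+n _ _) (accepts⇒fences-bound (replicate (suc n) false) t (trans (sym (isTiling≡accepts t)) ok))

angle≡∑ : ∀ m {N k} → k ≤ N → angle m (N ∸ k) k ≡ ∑[ t ∈ boards N ] indicator (isTiling m t ∧ (fences t =ℕ k))
angle≡∑ m {N} {k} k≤N =
  trans (cong (λ L → length (filter (λ t → T? (isTiling m t ∧ (fences t =ℕ k))) (boards L))) (m∸n+n≡m k≤N))
        (length-filter≡∑ (λ t → isTiling m t ∧ (fences t =ℕ k)) (boards N))

tilings : ℕ → ℕ → ℕ
tilings m N = ∑[ t ∈ boards N ] indicator (isTiling m t)

∑-angle≡tilings : ∀ N → sumTo ⌊ N /2⌋ (λ k → angle (suc n) (N ∸ k) k) ≡ tilings (suc n) N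
∑-angle≡tilings {n} N = begin
  ∑[ k ∈ upTo (suc K) ] angle (suc n) (N ∸ k) k
    ≡⟨ ∑-cong-local (All.map (λ k<1+K → angle≡∑ (suc n) (≤-trans (m<1+n⇒m≤n k<1+K) (⌊n/2⌋≤n N))) (all-upTo (suc K))) ⟩
  ∑[ k ∈ upTo (suc K) ] ∑[ t ∈ boards N ] indicator (isTiling (suc n) t ∧ (fences t =ℕ k))
    ≡⟨ ∑-comm (upTo (suc K)) (boards N) _ ⟩
  ∑[ t ∈ boards N ] ∑[ k ∈ upTo (suc K) ] indicator (isTiling (suc n) t ∧ (fences t =ℕ k))
    ≡⟨ ∑-cong-local (All.map (λ {t} len → ∑-indicator-=ℕ (isTiling (suc n) t) (fences t) K (fences≤K t len)) (boards-length N)) ⟩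
  tilings (suc n) N ∎
  where
  open ≡-Reasoning
  K = ⌊ N /2⌋
  fences≤K : ∀ t → length t ≡ N → isTiling (suc n) t ≡ true → fences t ≤ K
  fences≤K t refl = fences≤half t

tilings≡accepted : ∀ N → tilings (suc n) N ≡ accepted (replicate (suc n) false) N
tilings≡accepted N = ∑-cong (λ t → cong indicator (isTiling≡accepts t)) (boards N)

mainTheorem17 : (j m r : ℕ) → 1 ≤ m → r < m →
    sumTo ⌊ (m * j + r) /2⌋ (λ k → angle m (m * j + r ∸ k) k)
      ≡ fib j ^ (m ∸ r) * fib (j + 1) ^ r
mainTheorem17 j zero      r () _
mainTheorem17 j m@(suc n) r _  r<m = begin
  sumTo ⌊ N /2⌋ (λ k → angle m (N ∸ k) k)               ≡⟨ ∑-angle≡tilings N ⟩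
  tilings m N                                           ≡⟨ tilings≡accepted N ⟩
  accepted (replicate m false) N                        ≡⟨ accepted≡classProduct j r r≤m (replicate m false) ⟩
  classProduct (classLengths j r m) (replicate m false) ≡⟨ classProduct-vacant j m r≤m ⟩
  fib j ^ (m ∸ r) * fib (suc j) ^ r                     ≡⟨ cong (λ i → fib j ^ (m ∸ r) * fib i ^ r) (+-comm 1 j) ⟩
  fib j ^ (m ∸ r) * fib (j + 1) ^ r                     ∎
  where
  open ≡-Reasoning
  N = m * j + r
  r≤m = <⇒≤ r<m
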